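{- Let $0<c<1$, let $d$ be a positive non-square integer and let $\alpha\in\mathbb A_{c,d}$. Suppose $\mathfrak p\in S_\alpha$ and integers $m,n\ge0$, $v\ge1$ satisfy $\mathfrak p^v\mid(m+\alpha)\mathfrak a$ and $\mathfrak p^v\mid(n+\alpha)\mathfrak a$. Then $m\equiv n\pmod{p^v}$, where $p=\mathrm N(\mathfrak p)$.
   Context: $\mathbb{A}_{c,d}$ is the set of quadratic irrationals $\alpha=(b\pm\sqrt d)/a$, $a,b\in\mathbb Z_{>0}$, with $c<(b-\sqrt d)/a<(b+\sqrt d)/a<1$. $K=\mathbb Q(\alpha)$; $\mathfrak a$ is the ideal denominator of $\alpha$ (integral ideal with $(\alpha)=\mathfrak b\mathfrak a^{ -1}$, $\mathfrak a,\mathfrak b$ coprime integral). $S_\alpha$ is the set of prime ideals $\mathfrak p$ of $K$ above a rational prime $p$ with $(p)=\mathfrak p_1\mathfrak p_2$, $\mathfrak p_1\ne\mathfrak p_2$ (split primes).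
   Formalization: The parameter c is taken in ℚ rather than in ℝ. -}

module Defs where

open import Level using (0ℓ)
open import Data.Nat as ℕ using (ℕ)
open import Data.Integer as ℤ using (ℤ; +_)
open import Data.Rational as ℚ using (ℚ; 0ℚ; 1ℚ)
open import Data.Product using (Σ; Σ-syntax; _×_; _,_)
open import Data.Sum using (_⊎_)
open import Data.Nat.Primality using (Prime)
open import Relation.Nullary using (¬_)
open import Relation.Binary.PropositionalEquality using (_≡_)

ℕ→ℚ : ℕ → ℚ
ℕ→ℚ n = (+ n) ℚ./ 1

ℤ→ℚ : ℤ → ℚ
ℤ→ℚ z = z ℚ./ 1

NonSquare : ℕ → Set
NonSquare d = ¬ (Σ[ k ∈ ℕ ] k ℕ.* k ≡ d)

-- The quadratic field K = ℚ(√d), d a fixed positive non-square integer.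
-- An element  x + y√d  is represented by the pair (x , y) of rationals.

module QF (d : ℕ) where

  record K : Set where
    constructor _+√d·_
    field
      re : ℚ
      im : ℚ
  open K public

  D : ℚ
  D = ℕ→ℚ d

  ι : ℚ → K
  ι q = q +√d· 0ℚ

  _+K_ : K → K → K
  (x₁ +√d· y₁) +K (x₂ +√d· y₂) = (x₁ ℚ.+ x₂) +√d· (y₁ ℚ.+ y₂)

  _*K_ : K → K → K
  (x₁ +√d· y₁) *K (x₂ +√d· y₂) =
    (x₁ ℚ.* x₂ ℚ.+ D ℚ.* (y₁ ℚ.* y₂)) +√d· (x₁ ℚ.* y₂ ℚ.+ y₁ ℚ.* x₂)

  0K 1K : K
  0K = ι 0ℚ
  1K = ι 1ℚ

  σ : K → K
  σ (x +√d· y) = x +√d· (ℚ.- y)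

  -- Order induced by the real embedding √d > 0:
  -- x + y√d > 0 as a real number.
  Pos : K → Set
  Pos (x +√d· y) =
      (0ℚ ℚ.≤ x × 0ℚ ℚ.≤ y × (0ℚ ℚ.< x ⊎ 0ℚ ℚ.< y))
    ⊎ (0ℚ ℚ.< x × y ℚ.< 0ℚ × D ℚ.* (y ℚ.* y) ℚ.< x ℚ.* x)
    ⊎ (x ℚ.< 0ℚ × 0ℚ ℚ.< y × x ℚ.* x ℚ.< D ℚ.* (y ℚ.* y))

  _<K_ : K → K → Set
  u <K v = Pos (v +K (ι (ℚ.- 1ℚ) *K u))

  -- Ring of integers O_K: elements integral over ℤ
  -- (roots of a monic polynomial X² + tX + u with t, u ∈ ℤ; in a
  -- quadratic field every integral element is a root of such a polynomial).
  IsInt : K → Set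
  IsInt x = Σ[ t ∈ ℤ ] Σ[ u ∈ ℤ ]
    ((x *K x) +K ((ι (ℤ→ℚ t) *K x) +K ι (ℤ→ℚ u))) ≡ 0K

  Sub : Set₁
  Sub = K → Set

  _≐_ : Sub → Sub → Set
  A ≐ B = ∀ x → (A x → B x) × (B x → A x)

  record IsIdeal (I : Sub) : Set where
    field
      ⊆O    : ∀ x → I x → IsInt x
      0∈    : I 0K
      +-closed : ∀ x y → I x → I y → I (x +K y)
      O-closed : ∀ r x → IsInt r → I x → I (r *K x)

  O : Sub
  O = IsInt

  ⟨_⟩ : K → Sub
  ⟨ x ⟩ y = Σ[ r ∈ K ] IsInt r × y ≡ r *K x

  data _·_ (A B : Sub) : Sub where
    nil  : (A · B) 0K
    cons : ∀ {a b z} → A a → B b → (A · B) z → (A · B) ((a *K b) +K z)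

  _^_ : Sub → ℕ → Sub
  P ^ ℕ.zero  = O
  P ^ ℕ.suc v = P · (P ^ v)

  _∣_ : Sub → Sub → Set₁
  A ∣ B = Σ[ C ∈ Sub ] IsIdeal C × (B ≐ (A · C))

  IsPrimeIdeal : Sub → Set
  IsPrimeIdeal P = IsIdeal P × ¬ P 1K ×
    (∀ x y → IsInt x → IsInt y → P (x *K y) → P x ⊎ P y)

  Coprime : Sub → Sub → Set
  Coprime A B = Σ[ x ∈ K ] Σ[ y ∈ K ] A x × B y × (x +K y) ≡ 1K

  -- 𝔞 is the ideal denominator of α: 𝔞 integral and (α) = 𝔟 𝔞⁻¹
  -- (equivalently (α)𝔞 = 𝔟) with 𝔟 integral and 𝔞, 𝔟 coprime.
  IsIdealDenominator : K → Sub → Set₁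
  IsIdealDenominator α 𝔞 = IsIdeal 𝔞 × Σ[ 𝔟 ∈ Sub ]
    (IsIdeal 𝔟 × ((⟨ α ⟩ · 𝔞) ≐ 𝔟) × Coprime 𝔞 𝔟)

  -- 𝔭 ∈ S_α with underlying rational prime p:
  -- p is prime, (p) = 𝔭₁𝔭₂ with 𝔭₁ ≠ 𝔭₂ prime ideals, and 𝔭 ∈ {𝔭₁, 𝔭₂}.
  SplitPrimeAbove : ℕ → Sub → Set₁
  SplitPrimeAbove p 𝔭 = Prime p × Σ[ 𝔭₁ ∈ Sub ] Σ[ 𝔭₂ ∈ Sub ]
    (IsPrimeIdeal 𝔭₁ × IsPrimeIdeal 𝔭₂ ×
     (⟨ ι (ℕ→ℚ p) ⟩ ≐ (𝔭₁ · 𝔭₂)) × ¬ (𝔭₁ ≐ 𝔭₂) × (𝔭 ≐ 𝔭₁ ⊎ 𝔭 ≐ 𝔭₂))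

  -- α ∈ 𝔸_{c,d}: α = (b ± √d)/a with a, b ∈ ℤ_{>0} and
  -- c < (b − √d)/a < (b + √d)/a < 1.  (σ α is the other root.)
  InA : ℚ → K → Set
  InA c α = Σ[ a ∈ ℕ ] Σ[ b ∈ ℕ ] ℕ._<_ 0 a × ℕ._<_ 0 b ×
    (  (ι (ℕ→ℚ a) *K α ≡ ℕ→ℚ b +√d· 1ℚ
          × ι c <K σ α × σ α <K α × α <K 1K)
     ⊎ (ι (ℕ→ℚ a) *K α ≡ ℕ→ℚ b +√d· (ℚ.- 1ℚ)
          × ι c <K α × α <K σ α × σ α <K 1K))

{-# OPTIONS --safe #-}
-- Let (p) = P Q with P ≠ Q prime and 𝔭 ⊆ P.  As 𝔞 and (α)𝔞 are coprime, 1 = s + α t with s, t ∈ 𝔞, so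
--   m − n = (m + α) s − (n + α) s + m (n + α) t − n (m + α) t ∈ (m + α)𝔞 + (n + α)𝔞 ⊆ 𝔭ᵛ ⊆ Pᵛ.
-- For ω ∈ Q, ωᵛ Pᵛ ⊆ (P Q)ᵛ = (pᵛ), hence ωᵛ (m − n) = pᵛ r with r P ⊆ P.  Now peel off one p at a time:
-- if ωᵛ k = p r with r P ⊆ P for all ω ∈ Q but p ∤ k, then ωᵛ k ∈ P and k ∉ P, so Q ⊆ P as P is prime.
-- That is impossible, since comparable primes above p coincide: x ∈ P satisfies x² + t x + u = 0 with
-- u ∈ P ∩ ℤ = pℤ ⊆ Q, so x (x + t) ∈ Q, whence x ∈ Q.
module Submission where

open import Defs
open import Data.Nat using (ℕ; _^_; _≤_)
open import Data.Integer using (+_; _-_)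
open import Data.Integer.Divisibility using (_∣_)
open import Data.Rational using (ℚ; 0ℚ; 1ℚ; _<_)
open import Relation.Binary.PropositionalEquality using (_≡_)

open import Level using (0ℓ)
open import Function using (id; _∘_)
open import Data.List.Base using (_∷_; [])
open import Data.Product using (Σ-syntax; _×_; _,_; proj₁; proj₂; swap)
open import Data.Sum using (_⊎_; inj₁; inj₂; [_,_]′)
open import Relation.Nullary using (¬_; contradiction)
open import Relation.Nullary.Decidable using (dec⇒maybe; decidable-stable)
open import Relation.Binary.PropositionalEquality
  using (refl; sym; trans; cong; cong₂; subst; isEquivalence; module ≡-Reasoning)

import Data.Nat as ℕ
import Data.Nat.Properties as ℕP
open import Data.Nat.Divisibility using (divides; _∣?_; 1∣_; ∣-refl; *-pres-∣)
  renaming (_∣_ to _∣ℕ_)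
import Data.Nat.Coprimality as Coprimality
open import Data.Nat.GCD using (module Bézout)
open import Data.Nat.Primality using (Prime; prime⇒irreducible; prime⇒nonZero)
import Data.Integer as ℤ
import Data.Integer.Properties as ℤP
import Data.Rational as ℚ
import Data.Rational.Properties as ℚP

open import Algebra.Bundles using (CommutativeRing)
import Algebra.Structures
import Algebra.Consequences.Propositional as Consequences
open import Tactic.RingSolver using (solve)
open import Tactic.RingSolver.Core.AlmostCommutativeRing
  using (AlmostCommutativeRing; fromCommutativeRing)

prime∤⇒coprime : ∀ {p n} → Prime p → ¬ p ∣ℕ n → Coprimality.Coprime p n
prime∤⇒coprime {n = n} p-prime p∤n (i∣p , i∣n) with prime⇒irreducible p-prime i∣p
... | inj₁ i≡1 = i≡1
... | inj₂ i≡p = contradiction (subst (_∣ℕ n) i≡p i∣n) p∤n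

ℚ-ring : AlmostCommutativeRing 0ℓ 0ℓ
ℚ-ring = fromCommutativeRing ℚP.+-*-commutativeRing (λ x → dec⇒maybe (0ℚ ℚ.≟ x))

*-cancelˡ-≡ : ∀ c .{{_ : ℚ.NonZero c}} {a b} → c ℚ.* a ≡ c ℚ.* b → a ≡ b
*-cancelˡ-≡ c {a} {b} ca≡cb = trans (sym (1/c*[c*x]≡x a)) (trans (cong (ℚ.1/ c ℚ.*_) ca≡cb) (1/c*[c*x]≡x b))
  where
  open ≡-Reasoning
  1/c*[c*x]≡x : ∀ x → ℚ.1/ c ℚ.* (c ℚ.* x) ≡ x
  1/c*[c*x]≡x x = begin
    ℚ.1/ c ℚ.* (c ℚ.* x)  ≡⟨ ℚP.*-assoc (ℚ.1/ c) c x ⟨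
    (ℚ.1/ c ℚ.* c) ℚ.* x  ≡⟨ cong (ℚ._* x) (ℚP.*-inverseˡ c) ⟩
    1ℚ ℚ.* x              ≡⟨ ℚP.*-identityˡ x ⟩
    x                     ∎

ℤ→ℚ≡mkℚ : ∀ z → ℤ→ℚ z ≡ ℚ.mkℚ z 0 (Coprimality.sym (Coprimality.1-coprimeTo _))
ℤ→ℚ≡mkℚ (+ n)       = ℚP.normalize-coprime (Coprimality.sym (Coprimality.1-coprimeTo n))
ℤ→ℚ≡mkℚ ℤ.-[1+ n ] = cong ℚ.-_ (ℚP.normalize-coprime (Coprimality.sym (Coprimality.1-coprimeTo (ℕ.suc n))))

ℤ→ℚ-homo-+ : ∀ i j → ℤ→ℚ (i ℤ.+ j) ≡ ℤ→ℚ i ℚ.+ ℤ→ℚ j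
ℤ→ℚ-homo-+ i j = sym (trans (cong₂ ℚ._+_ (ℤ→ℚ≡mkℚ i) (ℤ→ℚ≡mkℚ j))
  (cong (ℚ._/ 1) (cong₂ ℤ._+_ (ℤP.*-identityʳ i) (ℤP.*-identityʳ j))))

ℤ→ℚ-homo-* : ∀ i j → ℤ→ℚ (i ℤ.* j) ≡ ℤ→ℚ i ℚ.* ℤ→ℚ j
ℤ→ℚ-homo-* i j = sym (cong₂ ℚ._*_ (ℤ→ℚ≡mkℚ i) (ℤ→ℚ≡mkℚ j))

ℤ→ℚ-homo‿- : ∀ i → ℤ→ℚ (ℤ.- i) ≡ ℚ.- ℤ→ℚ i
ℤ→ℚ-homo‿- (+ ℕ.zero)  = refl
ℤ→ℚ-homo‿- (+ ℕ.suc n) = refl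
ℤ→ℚ-homo‿- ℤ.-[1+ n ] = trans (ℤ→ℚ≡mkℚ _) (cong ℚ.-_ (sym (ℤ→ℚ≡mkℚ ℤ.-[1+ n ])))

ℕ→ℚ-nonZero : ∀ n .{{_ : ℕ.NonZero n}} → ℚ.NonZero (ℕ→ℚ n)
ℕ→ℚ-nonZero (ℕ.suc n) = subst ℚ.NonZero (sym (ℤ→ℚ≡mkℚ (+ ℕ.suc n))) _

module _ (d : ℕ) where
  open QF d hiding (_^_; _∣_)
  open QF d using () renaming (_^_ to _^ᴵ_; _∣_ to _∣ᴵ_)

  -K_ : K → K
  -K (x +√d· y) = (ℚ.- x) +√d· (ℚ.- y)

  -- Each `with D` generalises D = ℕ→ℚ d to a variable, which the solver requires.
  *K-assoc : ∀ x y z → (x *K y) *K z ≡ x *K (y *K z)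
  *K-assoc (a +√d· b) (c +√d· e) (f +√d· g) with D
  ... | D′ = cong₂ _+√d·_ (solve (D′ ∷ a ∷ b ∷ c ∷ e ∷ f ∷ g ∷ []) ℚ-ring)
                          (solve (D′ ∷ a ∷ b ∷ c ∷ e ∷ f ∷ g ∷ []) ℚ-ring)

  *K-comm : ∀ x y → x *K y ≡ y *K x
  *K-comm (a +√d· b) (c +√d· e) with D
  ... | D′ = cong₂ _+√d·_ (solve (D′ ∷ a ∷ b ∷ c ∷ e ∷ []) ℚ-ring) (solve (a ∷ b ∷ c ∷ e ∷ []) ℚ-ring)

  *K-identityˡ : ∀ x → 1K *K x ≡ x
  *K-identityˡ (a +√d· b) with D
  ... | D′ = cong₂ _+√d·_ (solve (D′ ∷ a ∷ b ∷ []) ℚ-ring) (solve (a ∷ b ∷ []) ℚ-ring)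

  *K-distribʳ : ∀ x y z → (y +K z) *K x ≡ (y *K x) +K (z *K x)
  *K-distribʳ (a +√d· b) (c +√d· e) (f +√d· g) with D
  ... | D′ = cong₂ _+√d·_ (solve (D′ ∷ a ∷ b ∷ c ∷ e ∷ f ∷ g ∷ []) ℚ-ring)
                          (solve (a ∷ b ∷ c ∷ e ∷ f ∷ g ∷ []) ℚ-ring)

  +K-comm : ∀ x y → x +K y ≡ y +K x
  +K-comm (a +√d· b) (c +√d· e) = cong₂ _+√d·_ (ℚP.+-comm a c) (ℚP.+-comm b e)

  K-isCommutativeRing : Algebra.Structures.IsCommutativeRing {A = K} _≡_ _+K_ _*K_ -K_ 0K 1K
  K-isCommutativeRing = record
    { isRing = record
      { +-isAbelianGroup = record
        { isGroup = record
          { isMonoid = record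
            { isSemigroup = record
              { isMagma = record { isEquivalence = isEquivalence ; ∙-cong = cong₂ _+K_ }
              ; assoc   = λ { (a +√d· b) (c +√d· e) (f +√d· g) →
                              cong₂ _+√d·_ (ℚP.+-assoc a c f) (ℚP.+-assoc b e g) }
              }
            ; identity = Consequences.comm∧idˡ⇒id +K-comm
                           (λ { (a +√d· b) → cong₂ _+√d·_ (ℚP.+-identityˡ a) (ℚP.+-identityˡ b) })
            }
          ; inverse = Consequences.comm∧invˡ⇒inv +K-comm
                        (λ { (a +√d· b) → cong₂ _+√d·_ (ℚP.+-inverseˡ a) (ℚP.+-inverseˡ b) })
          ; ⁻¹-cong = cong -K_
          }
        ; comm = +K-comm
        }
      ; *-cong     = cong₂ _*K_
      ; *-assoc    = *K-assoc
      ; *-identity = Consequences.comm∧idˡ⇒id *K-comm *K-identityˡ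
      ; distrib    = Consequences.comm∧distrʳ⇒distrˡ *K-comm *K-distribʳ , *K-distribʳ
      }
    ; *-comm = *K-comm
    }

  K-commutativeRing : CommutativeRing 0ℓ 0ℓ
  K-commutativeRing = record { isCommutativeRing = K-isCommutativeRing }

  open CommutativeRing K-commutativeRing
    using ( +-identityˡ; +-identityʳ; +-assoc; +-comm; *-assoc; *-comm; *-identityˡ; *-identityʳ
          ; zeroʳ; distribˡ; distribʳ; ring; *-commutativeSemigroup)
  open import Algebra.Properties.Ring ring
    using (-1*x≈-x; -‿involutive; //-rightDividesʳ; +-inverseˡ-unique; +-inverseʳ-unique)
  open import Algebra.Properties.CommutativeSemigroup *-commutativeSemigroup
    using (interchange; x∙yz≈y∙xz; xy∙z≈y∙xz; xy∙z≈yz∙x)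

  infixr 8 _^K_
  _^K_ : K → ℕ → K
  x ^K ℕ.zero  = 1K
  x ^K ℕ.suc n = x *K (x ^K n)

  ιℤ : ℤ.ℤ → K
  ιℤ z = ι (ℤ→ℚ z)

  ιℕ : ℕ → K
  ιℕ n = ι (ℕ→ℚ n)

  ι-homo-* : ∀ q r → ι (q ℚ.* r) ≡ ι q *K ι r
  ι-homo-* q r with D
  ... | D′ = cong₂ _+√d·_ (solve (D′ ∷ q ∷ r ∷ []) ℚ-ring) (solve (q ∷ r ∷ []) ℚ-ring)

  ι*K-componentwise : ∀ q a b → ι q *K (a +√d· b) ≡ (q ℚ.* a) +√d· (q ℚ.* b)
  ι*K-componentwise q a b with D
  ... | D′ = cong₂ _+√d·_ (solve (D′ ∷ q ∷ a ∷ b ∷ []) ℚ-ring) (solve (q ∷ a ∷ b ∷ []) ℚ-ring)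

  ιℤ-homo‿- : ∀ i → ιℤ (ℤ.- i) ≡ -K ιℤ i
  ιℤ-homo‿- i = cong ι (ℤ→ℚ-homo‿- i)

  ιℤ[m-n]≡ιℕm-ιℕn : ∀ m n → ιℤ (+ m - + n) ≡ ιℕ m +K (-K ιℕ n)
  ιℤ[m-n]≡ιℕm-ιℕn m n = trans (cong ι (ℤ→ℚ-homo-+ (+ m) (ℤ.- + n))) (cong (ιℕ m +K_) (ιℤ-homo‿- (+ n)))

  ιℕ-homo-+ : ∀ m n → ιℕ (m ℕ.+ n) ≡ ιℕ m +K ιℕ n
  ιℕ-homo-+ m n = cong ι (trans (cong ℤ→ℚ (ℤP.pos-+ m n)) (ℤ→ℚ-homo-+ (+ m) (+ n)))

  ιℕ-homo-* : ∀ m n → ιℕ (m ℕ.* n) ≡ ιℕ m *K ιℕ n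
  ιℕ-homo-* m n =
    trans (cong ι (trans (cong ℤ→ℚ (ℤP.pos-* m n)) (ℤ→ℚ-homo-* (+ m) (+ n)))) (ι-homo-* (ℕ→ℚ m) (ℕ→ℚ n))

  ιℕ-cancelˡ : ∀ n .{{_ : ℕ.NonZero n}} {x y} → ιℕ n *K x ≡ ιℕ n *K y → x ≡ y
  ιℕ-cancelˡ n {a +√d· b} {a′ +√d· b′} nx≡ny =
    cong₂ _+√d·_ (*-cancelˡ-≡ (ℕ→ℚ n) (cong re scaled)) (*-cancelˡ-≡ (ℕ→ℚ n) (cong im scaled))
    where
    instance _ = ℕ→ℚ-nonZero n
    scaled : (ℕ→ℚ n ℚ.* a) +√d· (ℕ→ℚ n ℚ.* b) ≡ (ℕ→ℚ n ℚ.* a′) +√d· (ℕ→ℚ n ℚ.* b′)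
    scaled = trans (sym (ι*K-componentwise (ℕ→ℚ n) a b)) (trans nx≡ny (ι*K-componentwise (ℕ→ℚ n) a′ b′))

  -- An integer z is a root of X (X − z).
  ιℤ-isInt : ∀ z → IsInt (ιℤ z)
  ιℤ-isInt z = ℤ.- z , + 0 ,
    trans (cong (λ c → (ιℤ z *K ιℤ z) +K ((ι c *K ιℤ z) +K 0K)) (ℤ→ℚ-homo‿- z)) (root (ℤ→ℚ z))
    where
    root : ∀ q → (ι q *K ι q) +K ((ι (ℚ.- q) *K ι q) +K 0K) ≡ 0K
    root q with D
    ... | D′ = cong₂ _+√d·_ (solve (D′ ∷ q ∷ []) ℚ-ring) (solve (q ∷ []) ℚ-ring)

  ιℕ-isInt : ∀ n → IsInt (ιℕ n)
  ιℕ-isInt n = ιℤ-isInt (+ n)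

  1K-isInt : IsInt 1K
  1K-isInt = ιℕ-isInt 1

  -1K-isInt : IsInt (-K 1K)
  -1K-isInt = ιℤ-isInt ℤ.-[1+ 0 ]

  _⊆_ : Sub → Sub → Set
  A ⊆ B = ∀ x → A x → B x

  ≐⇒⊆ : ∀ {A B} → A ≐ B → A ⊆ B
  ≐⇒⊆ A≐B x = proj₁ (A≐B x)

  ≐-sym : ∀ {A B} → A ≐ B → B ≐ A
  ≐-sym A≐B x = swap (A≐B x)

  record IsSubmodule (S : Sub) : Set where
    field
      0∈       : S 0K
      +-closed : ∀ {x y} → S x → S y → S (x +K y)
      *-closed : ∀ r {x} → IsInt r → S x → S (r *K x)

    *-closedʳ : ∀ r {x} → IsInt r → S x → S (x *K r)
    *-closedʳ r {x} r-int x∈S = subst S (*-comm r x) (*-closed r r-int x∈S)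

    -‿closed : ∀ {x} → S x → S (-K x)
    -‿closed {x} x∈S = subst S (-1*x≈-x x) (*-closed (-K 1K) -1K-isInt x∈S)

    ιℤ∈⇒ιℕ∣∣∈ : ∀ {z} → S (ιℤ z) → S (ιℕ ℤ.∣ z ∣)
    ιℤ∈⇒ιℕ∣∣∈ {+ n}       n∈S = n∈S
    ιℤ∈⇒ιℕ∣∣∈ {ℤ.-[1+ n ]} z∈S =
      subst S (-‿involutive (ιℕ (ℕ.suc n))) (-‿closed { -K ιℕ (ℕ.suc n) } (subst S (ιℤ-homo‿- (+ ℕ.suc n)) z∈S))

  isIdeal⇒isSubmodule : ∀ {I} → IsIdeal I → IsSubmodule I
  isIdeal⇒isSubmodule I-ideal = record
    { 0∈ = 0∈ ; +-closed = +-closed _ _ ; *-closed = λ r → O-closed r _ }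
    where open IsIdeal I-ideal

  module IdealProperties {I : Sub} (I-ideal : IsIdeal I) where
    open IsIdeal I-ideal public using (⊆O)
    open IsSubmodule (isIdeal⇒isSubmodule I-ideal) public

    ∈-+-cancelʳ : ∀ {x y} → I (x +K y) → I y → I x
    ∈-+-cancelʳ {x} {y} x+y∈I y∈I =
      subst I (//-rightDividesʳ y x) (+-closed {x +K y} { -K y } x+y∈I (-‿closed {y} y∈I))

    ∈-+-cancelˡ : ∀ {x y} → I (x +K y) → I x → I y
    ∈-+-cancelˡ {x} {y} x+y∈I = ∈-+-cancelʳ {y} {x} (subst I (+-comm x y) x+y∈I)

  *∈· : ∀ {A B a b} → A a → B b → (A · B) (a *K b)
  *∈· {A} {B} {a} {b} a∈A b∈B = subst (A · B) (+-identityʳ (a *K b)) (cons a∈A b∈B nil)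

  ·-⊆ : ∀ {A B S} → S 0K → (∀ {x y} → S x → S y → S (x +K y)) →
        (∀ {a b} → A a → B b → S (a *K b)) → (A · B) ⊆ S
  ·-⊆ 0∈S +-closed ab∈S _ nil                         = 0∈S
  ·-⊆ 0∈S +-closed ab∈S _ (cons {z = z} a∈A b∈B z∈AB) = +-closed (ab∈S a∈A b∈B) (·-⊆ 0∈S +-closed ab∈S z z∈AB)

  ·-+-closed : ∀ {A B x y} → (A · B) x → (A · B) y → (A · B) (x +K y)
  ·-+-closed {A} {B} {y = y} nil y∈AB = subst (A · B) (sym (+-identityˡ y)) y∈AB
  ·-+-closed {A} {B} {y = y} (cons {a} {b} {z} a∈A b∈B z∈AB) y∈AB =
    subst (A · B) (sym (+-assoc (a *K b) z y)) (cons a∈A b∈B (·-+-closed z∈AB y∈AB))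

  ·-comm : ∀ {A B} → (A · B) ⊆ (B · A)
  ·-comm {A} {B} = ·-⊆ nil ·-+-closed (λ {a} {b} a∈A b∈B → subst (B · A) (*-comm b a) (*∈· b∈B a∈A))

  ·-⊆ʳ : ∀ {A B} → IsIdeal A → IsIdeal B → (A · B) ⊆ B
  ·-⊆ʳ A-ideal B-ideal = ·-⊆ 0∈ +-closed (λ {a} a∈A → *-closed a (IsIdeal.⊆O A-ideal a a∈A))
    where open IsSubmodule (isIdeal⇒isSubmodule B-ideal)

  ·-mono : ∀ {A A′ B B′} → A ⊆ A′ → B ⊆ B′ → (A · B) ⊆ (A′ · B′)
  ·-mono A⊆A′ B⊆B′ _ nil                               = nil
  ·-mono A⊆A′ B⊆B′ _ (cons {a} {b} {z} a∈A b∈B z∈AB) = cons (A⊆A′ a a∈A) (B⊆B′ b b∈B) (·-mono A⊆A′ B⊆B′ z z∈AB)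

  ^-mono : ∀ {A B} → A ⊆ B → ∀ j → (A ^ᴵ j) ⊆ (B ^ᴵ j)
  ^-mono A⊆B ℕ.zero    = λ _ → id
  ^-mono A⊆B (ℕ.suc j) = ·-mono A⊆B (^-mono A⊆B j)

  principal·-intro : ∀ {𝔞} β {s} → 𝔞 s → (⟨ β ⟩ · 𝔞) (β *K s)
  principal·-intro β s∈𝔞 = *∈· (1K , 1K-isInt , sym (*-identityˡ β)) s∈𝔞

  principal·-elim : ∀ {𝔞 α} → IsIdeal 𝔞 → (⟨ α ⟩ · 𝔞) ⊆ (λ y → Σ[ s ∈ K ] (𝔞 s × y ≡ α *K s))
  principal·-elim {𝔞} {α} 𝔞-ideal = ·-⊆ (0K , 0∈ , sym (zeroʳ α)) sum product
    where
    open IsSubmodule (isIdeal⇒isSubmodule 𝔞-ideal)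
    sum : ∀ {x y} → Σ[ s ∈ K ] (𝔞 s × x ≡ α *K s) → Σ[ t ∈ K ] (𝔞 t × y ≡ α *K t) →
          Σ[ u ∈ K ] (𝔞 u × x +K y ≡ α *K u)
    sum (s , s∈𝔞 , x≡αs) (t , t∈𝔞 , y≡αt) =
      s +K t , +-closed {s} {t} s∈𝔞 t∈𝔞 , trans (cong₂ _+K_ x≡αs y≡αt) (sym (distribˡ α s t))
    product : ∀ {a b} → ⟨ α ⟩ a → 𝔞 b → Σ[ s ∈ K ] (𝔞 s × a *K b ≡ α *K s)
    product {b = b} (r , r-int , a≡rα) b∈𝔞 =
      r *K b , *-closed r r-int b∈𝔞 , trans (cong (_*K b) a≡rα) (xy∙z≈y∙xz r α b)

  module _ {p : ℕ} (p-prime : Prime p) where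

    ιℕ∈⇒∣ : ∀ {I} → IsIdeal I → ¬ I 1K → I (ιℕ p) → ∀ {n} → I (ιℕ n) → p ∣ℕ n
    ιℕ∈⇒∣ {I} I-ideal 1∉I p∈I {n} n∈I = decidable-stable (p ∣? n) λ p∤n →
      1∉I (bézout (Coprimality.coprime-Bézout (prime∤⇒coprime p-prime p∤n)))
      where
      open IdealProperties I-ideal
      multiple∈ : ∀ {a} k → I (ιℕ a) → I (ιℕ (k ℕ.* a))
      multiple∈ {a} k a∈I = subst I (sym (ιℕ-homo-* k a)) (*-closed (ιℕ k) {ιℕ a} (ιℕ-isInt k) a∈I)
      1∈I : ∀ {a b} → 1 ℕ.+ a ≡ b → I (ιℕ a) → I (ιℕ b) → I 1K
      1∈I {a} {b} 1+a≡b a∈I b∈I =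
        ∈-+-cancelʳ {ιℕ 1} {ιℕ a} (subst I (trans (cong ιℕ (sym 1+a≡b)) (ιℕ-homo-+ 1 a)) b∈I) a∈I
      bézout : Bézout.Identity 1 p n → I 1K
      bézout (Bézout.+- x y eq) = 1∈I eq (multiple∈ y n∈I) (multiple∈ x p∈I)
      bézout (Bézout.-+ x y eq) = 1∈I eq (multiple∈ x p∈I) (multiple∈ y n∈I)

    ιℤ∈-transfer : ∀ {I J} → IsIdeal I → ¬ I 1K → I (ιℕ p) → IsIdeal J → J (ιℕ p) →
                   ∀ {z} → I (ιℤ z) → J (ιℤ z)
    ιℤ∈-transfer {I} {J} I-ideal 1∉I p∈I J-ideal p∈J {z} = transfer z
      where
      module I = IdealProperties I-ideal
      module J = IdealProperties J-ideal
      multiple∈J : ∀ {n} → p ∣ℕ n → J (ιℕ n)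
      multiple∈J (divides q n≡qp) =
        subst J (trans (sym (ιℕ-homo-* q p)) (cong ιℕ (sym n≡qp))) (J.*-closed (ιℕ q) {ιℕ p} (ιℕ-isInt q) p∈J)
      transferℕ : ∀ n → I (ιℕ n) → J (ιℕ n)
      transferℕ n n∈I = multiple∈J (ιℕ∈⇒∣ I-ideal 1∉I p∈I {n} n∈I)
      transfer : ∀ z → I (ιℤ z) → J (ιℤ z)
      transfer (+ n)       = transferℕ n
      transfer ℤ.-[1+ n ] z∈I = subst J (sym (ιℤ-homo‿- (+ ℕ.suc n))) (J.-‿closed {ιℕ (ℕ.suc n)}
        (transferℕ (ℕ.suc n) (subst I (-‿involutive (ιℕ (ℕ.suc n)))
          (I.-‿closed { -K ιℕ (ℕ.suc n) } (subst I (ιℤ-homo‿- (+ ℕ.suc n)) z∈I)))))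

    -- For x ∈ I with x² + t x + u = 0, u ∈ I ∩ ℤ = pℤ ⊆ J gives x (x + t) ∈ J, and x + t ∈ J forces t ∈ J.
    primeAbove-⊆⇒⊇ : ∀ {I J} → IsIdeal I → ¬ I 1K → I (ιℕ p) → IsPrimeIdeal J → J (ιℕ p) → J ⊆ I → I ⊆ J
    primeAbove-⊆⇒⊇ {I} {J} I-ideal 1∉I p∈I (J-ideal , _ , J-prime) p∈J J⊆I x x∈I = ∈J (IsIdeal.⊆O I-ideal x x∈I)
      where
      module I = IdealProperties I-ideal
      module J = IdealProperties J-ideal
      transfer : ∀ {z} → I (ιℤ z) → J (ιℤ z)
      transfer {z} = ιℤ∈-transfer I-ideal 1∉I p∈I J-ideal p∈J {z}
      ∈J : IsInt x → J x
      ∈J (t , u , x²+tx+u≡0) = [ id , x+T∈J⇒x∈J ]′ (J-prime x (x +K T) (I.⊆O x x∈I) x+T-int x[x+T]∈J)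
        where
        open ≡-Reasoning
        T U : K
        T = ιℤ t
        U = ιℤ u
        x[x+T]+U≡0 : (x *K (x +K T)) +K U ≡ 0K
        x[x+T]+U≡0 = begin
          (x *K (x +K T)) +K U         ≡⟨ cong (_+K U) (distribˡ x x T) ⟩
          ((x *K x) +K (x *K T)) +K U  ≡⟨ +-assoc (x *K x) (x *K T) U ⟩
          (x *K x) +K ((x *K T) +K U)  ≡⟨ cong (λ y → (x *K x) +K (y +K U)) (*-comm x T) ⟩
          (x *K x) +K ((T *K x) +K U)  ≡⟨ x²+tx+u≡0 ⟩
          0K                           ∎
        x+T-int : IsInt (x +K T)
        x+T-int = ℤ.- t , u , (begin
          ((x +K T) *K (x +K T)) +K ((ιℤ (ℤ.- t) *K (x +K T)) +K U)
            ≡⟨ cong (λ c → ((x +K T) *K (x +K T)) +K ((c *K (x +K T)) +K U)) (ιℤ-homo‿- t) ⟩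
          ((x +K T) *K (x +K T)) +K (((-K T) *K (x +K T)) +K U)
            ≡⟨ +-assoc ((x +K T) *K (x +K T)) ((-K T) *K (x +K T)) U ⟨
          (((x +K T) *K (x +K T)) +K ((-K T) *K (x +K T))) +K U
            ≡⟨ cong (_+K U) (distribʳ (x +K T) (x +K T) (-K T)) ⟨
          (((x +K T) +K (-K T)) *K (x +K T)) +K U
            ≡⟨ cong (λ y → (y *K (x +K T)) +K U) (//-rightDividesʳ T x) ⟩
          (x *K (x +K T)) +K U
            ≡⟨ x[x+T]+U≡0 ⟩
          0K ∎)
        U∈I : I U
        U∈I = subst I (sym (+-inverseʳ-unique (x *K (x +K T)) U x[x+T]+U≡0))
                (I.-‿closed {x *K (x +K T)} (I.*-closedʳ (x +K T) {x} x+T-int x∈I))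
        x[x+T]∈J : J (x *K (x +K T))
        x[x+T]∈J = subst J (sym (+-inverseˡ-unique (x *K (x +K T)) U x[x+T]+U≡0)) (J.-‿closed {U} (transfer {u} U∈I))
        x+T∈J⇒x∈J : J (x +K T) → J x
        x+T∈J⇒x∈J x+T∈J = J.∈-+-cancelʳ {x} {T} x+T∈J (transfer {t} (I.∈-+-cancelˡ {x} {T} (J⊆I (x +K T) x+T∈J) x∈I))

  ^*-isInt : ∀ {Q ω c} → IsIdeal Q → Q ω → IsInt c → ∀ i → IsInt ((ω ^K i) *K c)
  ^*-isInt {c = c} Q-ideal ω∈Q c-int ℕ.zero = subst IsInt (sym (*-identityˡ c)) c-int
  ^*-isInt {Q} {ω} {c} Q-ideal ω∈Q c-int (ℕ.suc i) =
    ⊆O ((ω ^K ℕ.suc i) *K c) (subst Q (sym (xy∙z≈yz∙x ω (ω ^K i) c))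
      (*-closed ((ω ^K i) *K c) {ω} (^*-isInt Q-ideal ω∈Q c-int i) ω∈Q))
    where open IdealProperties Q-ideal

  prime-^*-split : ∀ {P Q ω c} → IsPrimeIdeal P → IsIdeal Q → Q ω → IsInt c →
                   ∀ i → P ((ω ^K i) *K c) → P ω ⊎ P c
  prime-^*-split {P} {c = c} _ _ _ _ ℕ.zero ω⁰c∈P = inj₂ (subst P (*-identityˡ c) ω⁰c∈P)
  prime-^*-split {P} {Q} {ω} {c} P-prime@(_ , _ , P-split) Q-ideal ω∈Q c-int (ℕ.suc i) ωⁱ⁺¹c∈P =
    [ inj₁ , prime-^*-split P-prime Q-ideal ω∈Q c-int i ]′
      (P-split ω ((ω ^K i) *K c) (IsIdeal.⊆O Q-ideal ω ω∈Q) (^*-isInt Q-ideal ω∈Q c-int i)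
        (subst P (*-assoc ω (ω ^K i) c) ωⁱ⁺¹c∈P))

  difference-expansion : ∀ M N A s t → (M +K (-K N)) *K (s +K (A *K t)) ≡
    (((M +K A) *K s) +K (-K ((N +K A) *K s))) +K ((M *K ((N +K A) *K t)) +K (-K (N *K ((M +K A) *K t))))
  difference-expansion (a +√d· b) (c +√d· e) (f +√d· g) (h +√d· i) (j +√d· k) with D
  ... | D′ = cong₂ _+√d·_ (solve (D′ ∷ a ∷ b ∷ c ∷ e ∷ f ∷ g ∷ h ∷ i ∷ j ∷ k ∷ []) ℚ-ring)
                          (solve (D′ ∷ a ∷ b ∷ c ∷ e ∷ f ∷ g ∷ h ∷ i ∷ j ∷ k ∷ []) ℚ-ring)

  combination∈ : ∀ {S} → IsSubmodule S → ∀ {M N A s t} → IsInt M → IsInt N →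
    S ((M +K A) *K s) → S ((N +K A) *K s) → S ((M +K A) *K t) → S ((N +K A) *K t) →
    S ((((M +K A) *K s) +K (-K ((N +K A) *K s))) +K ((M *K ((N +K A) *K t)) +K (-K (N *K ((M +K A) *K t)))))
  combination∈ S-sub {M} {N} {A} {s} {t} M-int N-int Ms Ns Mt Nt =
    +-closed (+-closed Ms (-‿closed Ns)) (+-closed (*-closed M M-int Nt) (-‿closed (*-closed N N-int Mt)))
    where open IsSubmodule S-sub

  difference∈ : ∀ {S α 𝔞 𝔟 M N} → IsSubmodule S → IsIdeal 𝔞 → (⟨ α ⟩ · 𝔞) ≐ 𝔟 → Coprime 𝔞 𝔟 →
                IsInt M → IsInt N → (⟨ M +K α ⟩ · 𝔞) ⊆ S → (⟨ N +K α ⟩ · 𝔞) ⊆ S → S (M +K (-K N))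
  difference∈ {S} {α} {𝔞} {𝔟} {M} {N} S-sub 𝔞-ideal α𝔞≐𝔟 (s , y , s∈𝔞 , y∈𝔟 , s+y≡1) M-int N-int M+α∣S N+α∣S =
    combine (principal·-elim {𝔞} {α} 𝔞-ideal y (≐⇒⊆ (≐-sym α𝔞≐𝔟) y y∈𝔟))
    where
    combine : Σ[ t ∈ K ] (𝔞 t × y ≡ α *K t) → S (M +K (-K N))
    combine (t , t∈𝔞 , y≡αt) = subst S (sym M-N≡) (combination∈ S-sub {M} {N} {α} {s} {t} M-int N-int
        (M+α∣S ((M +K α) *K s) (principal·-intro (M +K α) s∈𝔞)) (N+α∣S ((N +K α) *K s) (principal·-intro (N +K α) s∈𝔞))
        (M+α∣S ((M +K α) *K t) (principal·-intro (M +K α) t∈𝔞)) (N+α∣S ((N +K α) *K t) (principal·-intro (N +K α) t∈𝔞)))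
      where
      open ≡-Reasoning
      M-N≡ : M +K (-K N) ≡ (((M +K α) *K s) +K (-K ((N +K α) *K s))) +K ((M *K ((N +K α) *K t)) +K (-K (N *K ((M +K α) *K t))))
      M-N≡ = begin
        M +K (-K N)                         ≡⟨ *-identityʳ (M +K (-K N)) ⟨
        (M +K (-K N)) *K 1K                 ≡⟨ cong ((M +K (-K N)) *K_) (trans (sym s+y≡1) (cong (s +K_) y≡αt)) ⟩
        (M +K (-K N)) *K (s +K (α *K t))    ≡⟨ difference-expansion M N α s t ⟩
        _                                   ∎

  record SplitPair (p : ℕ) (P Q : Sub) : Set where
    field
      p-prime : Prime p
      P-prime : IsPrimeIdeal P
      Q-prime : IsPrimeIdeal Q
      P≢Q     : ¬ (P ≐ Q)
      ⟨p⟩≐P·Q : ⟨ ιℕ p ⟩ ≐ (P · Q)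

  SplitPair-swap : ∀ {p P Q} → SplitPair p P Q → SplitPair p Q P
  SplitPair-swap split = record
    { p-prime = p-prime
    ; P-prime = Q-prime
    ; Q-prime = P-prime
    ; P≢Q     = P≢Q ∘ ≐-sym
    ; ⟨p⟩≐P·Q = λ x → ·-comm x ∘ proj₁ (⟨p⟩≐P·Q x) , proj₂ (⟨p⟩≐P·Q x) ∘ ·-comm x
    }
    where open SplitPair split

  splitPrimeAbove⇒SplitPair : ∀ {p 𝔭} → SplitPrimeAbove p 𝔭 → Σ[ P ∈ Sub ] Σ[ Q ∈ Sub ] (𝔭 ⊆ P × SplitPair p P Q)
  splitPrimeAbove⇒SplitPair {p} (p-prime , 𝔭₁ , 𝔭₂ , 𝔭₁-prime , 𝔭₂-prime , ⟨p⟩≐𝔭₁·𝔭₂ , 𝔭₁≢𝔭₂ , 𝔭≐𝔭ᵢ) =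
    [ (λ 𝔭≐𝔭₁ → 𝔭₁ , 𝔭₂ , ≐⇒⊆ 𝔭≐𝔭₁ , split) , (λ 𝔭≐𝔭₂ → 𝔭₂ , 𝔭₁ , ≐⇒⊆ 𝔭≐𝔭₂ , SplitPair-swap split) ]′ 𝔭≐𝔭ᵢ
    where
    split : SplitPair p 𝔭₁ 𝔭₂
    split = record
      { p-prime = p-prime ; P-prime = 𝔭₁-prime ; Q-prime = 𝔭₂-prime ; P≢Q = 𝔭₁≢𝔭₂ ; ⟨p⟩≐P·Q = ⟨p⟩≐𝔭₁·𝔭₂ }

  module SplitPrime {p P Q} (split : SplitPair p P Q) where
    open SplitPair split

    P-ideal : IsIdeal P
    P-ideal = proj₁ P-prime

    Q-ideal : IsIdeal Q
    Q-ideal = proj₁ Q-prime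

    1∉P : ¬ P 1K
    1∉P = proj₁ (proj₂ P-prime)

    module P = IdealProperties P-ideal

    p∈P·Q : (P · Q) (ιℕ p)
    p∈P·Q = ≐⇒⊆ ⟨p⟩≐P·Q (ιℕ p) (1K , 1K-isInt , sym (*-identityˡ (ιℕ p)))

    p∈P : P (ιℕ p)
    p∈P = ·-⊆ʳ Q-ideal P-ideal (ιℕ p) (·-comm (ιℕ p) p∈P·Q)

    p∈Q : Q (ιℕ p)
    p∈Q = ·-⊆ʳ P-ideal Q-ideal (ιℕ p) p∈P·Q

    P·Q⊆⟨p⟩ : ∀ {a ω} → P a → Q ω → ⟨ ιℕ p ⟩ (a *K ω)
    P·Q⊆⟨p⟩ {a} {ω} a∈P ω∈Q = ≐⇒⊆ (≐-sym ⟨p⟩≐P·Q) (a *K ω) (*∈· {P} {Q} {a} {ω} a∈P ω∈Q)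

    -- The multiplier ring (P : P) ⊇ O_K collects cofactors: unlike IsInt, it is visibly closed under + and *.
    Multiplier : K → Set
    Multiplier r = ∀ y → P y → P (r *K y)

    isInt⇒Multiplier : ∀ r → IsInt r → Multiplier r
    isInt⇒Multiplier r r-int y = P.*-closed r {y} r-int

    Multiplier-* : ∀ {r s} → Multiplier r → Multiplier s → Multiplier (r *K s)
    Multiplier-* {r} {s} r-mult s-mult y y∈P = subst P (sym (*-assoc r s y)) (r-mult (s *K y) (s-mult y y∈P))

    Multiplier-+ : ∀ {r s} → Multiplier r → Multiplier s → Multiplier (r +K s)
    Multiplier-+ {r} {s} r-mult s-mult y y∈P =
      subst P (sym (distribʳ y r s)) (P.+-closed {r *K y} {s *K y} (r-mult y y∈P) (s-mult y y∈P))

    Multiplier-^ : ∀ {r} → Multiplier r → ∀ j → Multiplier (r ^K j)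
    Multiplier-^ r-mult ℕ.zero        = isInt⇒Multiplier 1K 1K-isInt
    Multiplier-^ {r} r-mult (ℕ.suc j) = Multiplier-* {r} {r ^K j} r-mult (Multiplier-^ {r} r-mult j)

    Cofactor : ℕ → ℕ → K → K → Set
    Cofactor i j ω x = Σ[ r ∈ K ] (Multiplier r × (ω ^K i) *K x ≡ (ιℕ p ^K j) *K r)

    Divisible : ℕ → ℕ → K → Set
    Divisible i j x = ∀ ω → Q ω → Cofactor i j ω x

    Divisible-isSubmodule : ∀ i j → IsSubmodule (Divisible i j)
    Divisible-isSubmodule i j = record
      { 0∈       = λ ω _ → 0K , isInt⇒Multiplier 0K (ιℕ-isInt 0) , trans (zeroʳ (ω ^K i)) (sym (zeroʳ (ιℕ p ^K j)))
      ; +-closed = λ {x} {y} x-div y-div ω ω∈Q → sum {ω} {x} {y} (x-div ω ω∈Q) (y-div ω ω∈Q)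
      ; *-closed = λ c {x} c-int x-div ω ω∈Q → scale {ω} {x} c c-int (x-div ω ω∈Q)
      }
      where
      open ≡-Reasoning
      sum : ∀ {ω x y} → Cofactor i j ω x → Cofactor i j ω y → Cofactor i j ω (x +K y)
      sum {ω} {x} {y} (r , r-mult , ωⁱx≡pʲr) (s , s-mult , ωⁱy≡pʲs) =
        r +K s , Multiplier-+ {r} {s} r-mult s-mult , (begin
          (ω ^K i) *K (x +K y)                     ≡⟨ distribˡ (ω ^K i) x y ⟩
          ((ω ^K i) *K x) +K ((ω ^K i) *K y)       ≡⟨ cong₂ _+K_ ωⁱx≡pʲr ωⁱy≡pʲs ⟩
          ((ιℕ p ^K j) *K r) +K ((ιℕ p ^K j) *K s) ≡⟨ distribˡ (ιℕ p ^K j) r s ⟨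
          (ιℕ p ^K j) *K (r +K s)                  ∎)
      scale : ∀ {ω x} c → IsInt c → Cofactor i j ω x → Cofactor i j ω (c *K x)
      scale {ω} {x} c c-int (r , r-mult , ωⁱx≡pʲr) =
        c *K r , Multiplier-* {c} {r} (isInt⇒Multiplier c c-int) r-mult , (begin
          (ω ^K i) *K (c *K x)       ≡⟨ x∙yz≈y∙xz (ω ^K i) c x ⟩
          c *K ((ω ^K i) *K x)       ≡⟨ cong (c *K_) ωⁱx≡pʲr ⟩
          c *K ((ιℕ p ^K j) *K r)    ≡⟨ x∙yz≈y∙xz c (ιℕ p ^K j) r ⟩
          (ιℕ p ^K j) *K (c *K r)    ∎)

    *-Divisible : ∀ {a b j} → P a → Divisible j j b → Divisible (ℕ.suc j) (ℕ.suc j) (a *K b)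
    *-Divisible {a} {b} {j} a∈P b-div ω ω∈Q = combine (P·Q⊆⟨p⟩ {a} {ω} a∈P ω∈Q) (b-div ω ω∈Q)
      where
      open ≡-Reasoning
      combine : ⟨ ιℕ p ⟩ (a *K ω) → Cofactor j j ω b → Cofactor (ℕ.suc j) (ℕ.suc j) ω (a *K b)
      combine (r , r-int , aω≡rp) (s , s-mult , ωʲb≡pʲs) =
        r *K s , Multiplier-* {r} {s} (isInt⇒Multiplier r r-int) s-mult , (begin
          (ω *K (ω ^K j)) *K (a *K b)             ≡⟨ interchange ω (ω ^K j) a b ⟩
          (ω *K a) *K ((ω ^K j) *K b)             ≡⟨ cong₂ _*K_ (trans (*-comm ω a) aω≡rp) ωʲb≡pʲs ⟩
          (r *K ιℕ p) *K ((ιℕ p ^K j) *K s)       ≡⟨ cong (_*K ((ιℕ p ^K j) *K s)) (*-comm r (ιℕ p)) ⟩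
          (ιℕ p *K r) *K ((ιℕ p ^K j) *K s)       ≡⟨ interchange (ιℕ p) r (ιℕ p ^K j) s ⟩
          (ιℕ p *K (ιℕ p ^K j)) *K (r *K s)       ∎)

    ^⊆Divisible : ∀ j → (P ^ᴵ j) ⊆ Divisible j j
    ^⊆Divisible ℕ.zero    x x-int _ _ = x , isInt⇒Multiplier x x-int , refl
    ^⊆Divisible (ℕ.suc j) = ·-⊆ {S = Divisible (ℕ.suc j) (ℕ.suc j)} 0∈ +-closed
      (λ {a} {b} a∈P b∈Pʲ → *-Divisible {a} {b} {j} a∈P (^⊆Divisible j b b∈Pʲ))
      where open IsSubmodule (Divisible-isSubmodule (ℕ.suc j) (ℕ.suc j))

    ∣⇒⊆Divisible : ∀ {𝔭 v B} → 𝔭 ⊆ P → (𝔭 ^ᴵ v) ∣ᴵ B → B ⊆ Divisible v v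
    ∣⇒⊆Divisible {𝔭} {v} {B} 𝔭⊆P (C , C-ideal , B≐𝔭ᵛ·C) x x∈B =
      ·-⊆ {S = Divisible v v} 0∈ +-closed
        (λ {a} {c} a∈𝔭ᵛ c∈C → *-closedʳ c {a} (IsIdeal.⊆O C-ideal c c∈C) (^⊆Divisible v a (^-mono 𝔭⊆P v a a∈𝔭ᵛ)))
        x (≐⇒⊆ B≐𝔭ᵛ·C x x∈B)
      where open IsSubmodule (Divisible-isSubmodule v v)

    Divisible-cancel-p : ∀ {i j q} → Divisible i (ℕ.suc j) (ιℕ (q ℕ.* p)) → Divisible i j (ιℕ q)
    Divisible-cancel-p {i} {j} {q} qp-div ω ω∈Q = cancel (qp-div ω ω∈Q)
      where
      open ≡-Reasoning
      instance _ = prime⇒nonZero p-prime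
      cancel : Cofactor i (ℕ.suc j) ω (ιℕ (q ℕ.* p)) → Cofactor i j ω (ιℕ q)
      cancel (r , r-mult , ωⁱqp≡pʲ⁺¹r) = r , r-mult , ιℕ-cancelˡ p {(ω ^K i) *K ιℕ q} {(ιℕ p ^K j) *K r} (begin
        ιℕ p *K ((ω ^K i) *K ιℕ q)    ≡⟨ x∙yz≈y∙xz (ιℕ p) (ω ^K i) (ιℕ q) ⟩
        (ω ^K i) *K (ιℕ p *K ιℕ q)    ≡⟨ cong ((ω ^K i) *K_) (trans (*-comm (ιℕ p) (ιℕ q)) (sym (ιℕ-homo-* q p))) ⟩
        (ω ^K i) *K ιℕ (q ℕ.* p)      ≡⟨ ωⁱqp≡pʲ⁺¹r ⟩
        (ιℕ p *K (ιℕ p ^K j)) *K r    ≡⟨ *-assoc (ιℕ p) (ιℕ p ^K j) r ⟩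
        ιℕ p *K ((ιℕ p ^K j) *K r)    ∎)

    Divisible⇒∈P : ∀ {i j x} → Divisible i (ℕ.suc j) x → ∀ ω → Q ω → P ((ω ^K i) *K x)
    Divisible⇒∈P {i} {j} {x} x-div ω ω∈Q = ∈P (x-div ω ω∈Q)
      where
      ∈P : Cofactor i (ℕ.suc j) ω x → P ((ω ^K i) *K x)
      ∈P (r , r-mult , ωⁱx≡pʲ⁺¹r) =
        subst P (sym (trans ωⁱx≡pʲ⁺¹r (xy∙z≈yz∙x (ιℕ p) (ιℕ p ^K j) r)))
          (Multiplier-* {ιℕ p ^K j} {r} (Multiplier-^ {ιℕ p} (isInt⇒Multiplier (ιℕ p) (ιℕ-isInt p)) j) r-mult (ιℕ p) p∈P)

    Divisible∧∤⇒Q⊆P : ∀ {i j n} → Divisible i (ℕ.suc j) (ιℕ n) → ¬ p ∣ℕ n → Q ⊆ P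
    Divisible∧∤⇒Q⊆P {i} {j} {n} n-div p∤n ω ω∈Q =
      [ id , (λ n∈P → contradiction (ιℕ∈⇒∣ p-prime P-ideal 1∉P p∈P {n} n∈P) p∤n) ]′
        (prime-^*-split P-prime Q-ideal ω∈Q (ιℕ-isInt n) i (Divisible⇒∈P {i} {j} {ιℕ n} n-div ω ω∈Q))

    Divisible⇒∣ : ∀ {i} j {n} → Divisible i j (ιℕ n) → p ^ j ∣ℕ n
    Divisible⇒∣ ℕ.zero {n} _ = 1∣ n
    Divisible⇒∣ {i} (ℕ.suc j) {n} n-div = peel (decidable-stable (p ∣? n) λ p∤n → P≢Q λ x → P⊆Q p∤n x , Q⊆P p∤n x)
      where
      Q⊆P : ¬ p ∣ℕ n → Q ⊆ P
      Q⊆P = Divisible∧∤⇒Q⊆P {i} {j} {n} n-div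
      P⊆Q : ¬ p ∣ℕ n → P ⊆ Q
      P⊆Q = primeAbove-⊆⇒⊇ p-prime P-ideal 1∉P p∈P Q-prime p∈Q ∘ Q⊆P
      peel : p ∣ℕ n → p ^ ℕ.suc j ∣ℕ n
      peel (divides q n≡qp) = subst (p ^ ℕ.suc j ∣ℕ_) (trans (ℕP.*-comm p q) (sym n≡qp))
        (*-pres-∣ (∣-refl {p}) (Divisible⇒∣ {i} j {q} (Divisible-cancel-p {i} {j} {q} (subst (Divisible i (ℕ.suc j) ∘ ιℕ) n≡qp n-div))))

lemma4p3 : (c : ℚ) → 0ℚ < c → c < 1ℚ →
    (d : ℕ) → 1 ≤ d → NonSquare d →
    (α : QF.K d) → QF.InA d c α →
    (𝔞 : QF.Sub d) → QF.IsIdealDenominator d α 𝔞 →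
    (p : ℕ) (𝔭 : QF.Sub d) → QF.SplitPrimeAbove d p 𝔭 →
    (m n v : ℕ) → 1 ≤ v →
    QF._∣_ d (QF._^_ d 𝔭 v) (QF._·_ d (QF.⟨_⟩ d (QF._+K_ d (QF.ι d (ℕ→ℚ m)) α)) 𝔞) →
    QF._∣_ d (QF._^_ d 𝔭 v) (QF._·_ d (QF.⟨_⟩ d (QF._+K_ d (QF.ι d (ℕ→ℚ n)) α)) 𝔞) →
    (+ (p ^ v)) ∣ ((+ m) - (+ n))
lemma4p3 _ _ _ d _ _ α _ 𝔞 (𝔞-ideal , 𝔟 , _ , α𝔞≐𝔟 , 𝔞+𝔟∋1) p 𝔭 𝔭-split m n v _ 𝔭ᵛ∣[m+α]𝔞 𝔭ᵛ∣[n+α]𝔞 =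
  p^v∣m-n (splitPrimeAbove⇒SplitPair d 𝔭-split)
  where
  p^v∣m-n : Σ[ P ∈ QF.Sub d ] Σ[ Q ∈ QF.Sub d ] (_⊆_ d 𝔭 P × SplitPair d p P Q) → (+ (p ^ v)) ∣ ((+ m) - (+ n))
  p^v∣m-n (P , Q , 𝔭⊆P , split) =
    Divisible⇒∣ {v} v {ℤ.∣ + m - + n ∣} (IsSubmodule.ιℤ∈⇒ιℕ∣∣∈ (Divisible-isSubmodule v v) {+ m - + n} m-n-Divisible)
    where
    open SplitPrime d split
    m-n-Divisible : Divisible v v (ιℤ d (+ m - + n))
    m-n-Divisible = subst (Divisible v v) (sym (ιℤ[m-n]≡ιℕm-ιℕn d m n))
      (difference∈ d {Divisible v v} {α} {𝔞} {𝔟} {ιℕ d m} {ιℕ d n} (Divisible-isSubmodule v v) 𝔞-ideal α𝔞≐𝔟 𝔞+𝔟∋1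
        (ιℕ-isInt d m) (ιℕ-isInt d n) (∣⇒⊆Divisible {𝔭} {v} 𝔭⊆P 𝔭ᵛ∣[m+α]𝔞) (∣⇒⊆Divisible {𝔭} {v} 𝔭⊆P 𝔭ᵛ∣[n+α]𝔞))
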